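{- Let $\mathcal{K}$ be the set of conflicting pairs defined in the context. Every feasible solution $(x,y,f,\varphi)$ of $\mathcal{F}_2$ satisfies $$\sum_{e\in\delta^+(V)}x_e\ \ge\ y_i+y_j\quad\text{for all }\langle i,j\rangle\in\mathcal{K}\text{ and all }V\subseteq N\setminus\{t\}\text{ with }\{i,j\}\subseteq V.$$
   Context: Setting (Steiner Team Orienteering Problem). $G=(N,A)$ is a digraph with distinct vertices $s,t\in N$; $N\setminus\{s,t\}$ is partitioned into disjoint sets $S$ (mandatory vertices) and $P$ (profitable vertices). Each $i\in P$ has a reward $p_i\in\mathbb{Z}^+$, each arc $(i,j)\in A$ has a positive real traverse time $d_{ij}\in\mathbb{R}^+$, $m$ is a positive integer (number of vehicles) and $T$ is a time limit. For $i\in N$, $\delta^+(i)=\{j\in N:(i,j)\in A\}$ and $\delta^-(i)=\{j\in N:(j,i)\in A\}$; for $V\subseteq N$, $\delta^+(V)$ (resp. $\delta^-(V)$) is the set of arcs $(i,j)\in A$ with $i\in V,j\notin V$ (resp. $i\notin V,j\in V$). For $i,j\in N$, $R_{ij}$ is the minimum total traverse time of a directed path from $i$ to $j$ in $G$, with $R_{ii}=0$. A route is a directed path from $s$ to $t$ in $G$ visiting each vertex at most once; its traverse time is the sum of $d$ over its arcs. $\mathcal{K}$ is the set of pairs $\langle i,j\rangle$ of distinct vertices $i,j\in N\setminus\{s,t\}$ such that every route visiting both $i$ and $j$ (in either order) has traverse time exceeding $T$. $\mathcal{F}_2$: maximize $\sum_{i\in P}p_iy_i$ over variables $x_{ij}$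 ($(i,j)\in A$), $y_i$ ($i\in N$), $f_{ij}$ ($(i,j)\in A$), $\varphi$, subject to: $y_i=1$ for all $i\in S\cup\{s,t\}$; $\sum_{j\in\delta^+(i)}x_{ij}=y_i$ for all $i\in S\cup P$; $\sum_{j\in\delta^+(s)}x_{sj}=\sum_{i\in\delta^-(t)}x_{it}=m-\varphi$; $\sum_{i\in\delta^-(s)}x_{is}=\sum_{j\in\delta^+(t)}x_{tj}=0$; $\sum_{j\in\delta^+(i)}x_{ij}-\sum_{j\in\delta^-(i)}x_{ji}=0$ for all $i\in S\cup P$; $f_{sj}=(T-d_{sj})x_{sj}$ for all $j\in\delta^+(s)$; $\sum_{j\in\delta^-(i)}f_{ji}-\sum_{j\in\delta^+(i)}f_{ij}=\sum_{j\in\delta^+(i)}d_{ij}x_{ij}$ for all $i\in S\cup P$; $f_{ij}\le (T-R_{si}-d_{ij})x_{ij}$ for all $(i,j)\in A$ with $i\ne s$; $f_{ij}\ge R_{jt}x_{ij}$ for all $(i,j)\in A$; $x\in\{0,1\}^A$, $y\in\{0,1\}^N$, $f\ge0$, $0\le\varphi\le m$. -}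

module Defs where

open import Level using (0ℓ)
open import Data.Nat using (ℕ; zero; suc)
open import Data.Fin using (Fin)
open import Data.Bool using (Bool; true; false; if_then_else_; _∧_; not)
open import Data.List using (List; []; _∷_)
open import Data.List.Membership.Propositional using (_∈_)
open import Data.List.Relation.Unary.Unique.Propositional using (Unique)
open import Data.Product using (_×_; Σ; ∃; ∃-syntax)
open import Data.Sum using (_⊎_)
open import Relation.Binary.Core using (Rel)
open import Relation.Binary.Structures using (IsTotalOrder)
open import Relation.Binary.PropositionalEquality using (_≡_; _≢_)
open import Algebra.Structures using (IsCommutativeRing)

-- Ordered fields (the reals ℝ are a model).  The stdlib has no reals, so
-- the statement is proved for every (discrete) ordered field.

record OrderedField : Set₁ where
  infixl 6 _+_ _-_
  infixl 7 _*_
  infix 4 _≤_ _<_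
  field
    Carrier : Set
    _+_ _*_ : Carrier → Carrier → Carrier
    -_      : Carrier → Carrier
    0# 1#   : Carrier
    isCommutativeRing : IsCommutativeRing _≡_ _+_ _*_ -_ 0# 1#
    _≤_     : Rel Carrier 0ℓ
    isTotalOrder : IsTotalOrder _≡_ _≤_
    +-monoˡ-≤ : ∀ {a b} c → a ≤ b → a + c ≤ b + c
    *-nonneg  : ∀ {a b} → 0# ≤ a → 0# ≤ b → 0# ≤ a * b
    0≢1       : 0# ≢ 1#
    inverse   : ∀ a → a ≢ 0# → ∃[ b ] (a * b ≡ 1#)

  _-_ : Carrier → Carrier → Carrier
  a - b = a + (- b)

  _<_ : Rel Carrier 0ℓ
  a < b = a ≤ b × a ≢ b

  fromℕ : ℕ → Carrier
  fromℕ zero    = 0#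
  fromℕ (suc k) = 1# + fromℕ k

  ∑ : ∀ {n} → (Fin n → Carrier) → Carrier
  ∑ {zero}  g = 0#
  ∑ {suc n} g = g Fin.zero + ∑ (λ i → g (Fin.suc i))

  [_]_ : Bool → Carrier → Carrier
  [ b ] a = if b then a else 0#

  binary : Carrier → Set
  binary a = a ≡ 0# ⊎ a ≡ 1#

-- An STOP instance: digraph on vertex set N = Fin n with arc relation
-- given by the Boolean adjacency A (arc (i,j) ∈ A iff A i j ≡ true),
-- source s, sink t, mandatory set S = {i ∉ {s,t} | isS i ≡ true},
-- profitable set P = {i ∉ {s,t} | isS i ≡ false}, arc times d,
-- m vehicles, time limit T.

module STOP (𝔽 : OrderedField) {n : ℕ}
            (A : Fin n → Fin n → Bool)
            (s t : Fin n)
            (isS : Fin n → Bool)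
            (d : Fin n → Fin n → OrderedField.Carrier 𝔽)
            (m : ℕ)
            (T : OrderedField.Carrier 𝔽) where

  open OrderedField 𝔽

  Arc : Fin n → Fin n → Set
  Arc i j = A i j ≡ true

  -- i ∈ S ∪ P  (i.e. i ∈ N ∖ {s,t})
  Inner : Fin n → Set
  Inner i = i ≢ s × i ≢ t

  InS : Fin n → Set
  InS i = Inner i × isS i ≡ true

  data Walk : Fin n → Fin n → Set where
    [] : ∀ {i} → Walk i i
    _∷_ : ∀ {i k j} → Arc i k → Walk k j → Walk i j

  vertices : ∀ {i j} → Walk i j → List (Fin n)
  vertices {i} []       = i ∷ []
  vertices {i} (_ ∷ w)  = i ∷ vertices w

  time : ∀ {i j} → Walk i j → Carrier
  time [] = 0#
  time {i} (_∷_ {k = k} _ w) = d i k + time w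

  record Path (i j : Fin n) : Set where
    constructor path
    field
      walk   : Walk i j
      simple : Unique (vertices walk)

  pathTime : ∀ {i j} → Path i j → Carrier
  pathTime p = time (Path.walk p)

  visits : ∀ {i j} → Fin n → Path i j → Set
  visits v p = v ∈ vertices (Path.walk p)

  Route : Set
  Route = Path s t

  IsMinPathTime : Fin n → Fin n → Carrier → Set
  IsMinPathTime i j r =
    (∀ (p : Path i j) → r ≤ pathTime p) ×
    (Path i j → Σ (Path i j) λ q → pathTime q ≡ r)

  Conflicting : Fin n → Fin n → Set
  Conflicting i j =
    Inner i × Inner j × i ≢ j ×
    (∀ (p : Route) → visits i p → visits j p → T < pathTime p)

  out : (Fin n → Fin n → Carrier) → Fin n → Carrier
  out g i = ∑ λ j → [ A i j ] g i j

  inn : (Fin n → Fin n → Carrier) → Fin n → Carrier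
  inn g i = ∑ λ j → [ A j i ] g j i

  cut : (Fin n → Fin n → Carrier) → (Fin n → Bool) → Carrier
  cut g V = ∑ λ i → ∑ λ j → [ A i j ∧ V i ∧ not (V j) ] g i j

  -- feasibility for formulation 𝓕₂ (objective irrelevant for feasibility)
  record Feasible (R : Fin n → Fin n → Carrier)
                  (x : Fin n → Fin n → Carrier)
                  (y : Fin n → Carrier)
                  (f : Fin n → Fin n → Carrier)
                  (φ : Carrier) : Set where
    field
      y-fixed   : ∀ i → InS i ⊎ i ≡ s ⊎ i ≡ t → y i ≡ 1#
      out-deg   : ∀ i → Inner i → out x i ≡ y i
      s-out     : out x s ≡ fromℕ m - φ
      t-in      : inn x t ≡ fromℕ m - φ
      s-in      : inn x s ≡ 0#
      t-out     : out x t ≡ 0#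
      conserve  : ∀ i → Inner i → out x i - inn x i ≡ 0#
      f-source  : ∀ j → Arc s j → f s j ≡ (T - d s j) * x s j
      f-balance : ∀ i → Inner i →
                  inn f i - out f i ≡ out (λ a b → d a b * x a b) i
      f-upper   : ∀ i j → Arc i j → i ≢ s → f i j ≤ (T - R s i - d i j) * x i j
      f-lower   : ∀ i j → Arc i j → R j t * x i j ≤ f i j
      x-binary  : ∀ i j → Arc i j → binary (x i j)
      y-binary  : ∀ i → binary (y i)
      f-nonneg  : ∀ i j → Arc i j → 0# ≤ f i j
      φ-nonneg  : 0# ≤ φ
      φ-le-m    : φ ≤ fromℕ m

module Submission where

-- At an inner vertex with y = 1 the arcs carrying x = 1 enter and leave exactly once, and
-- the inflow π of f drops by d > 0 along each of them.  Hence from such a vertex they trace a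
-- simple path to t, which extends backwards to s, and the resulting route takes at most
-- d(s,k) + f(s,k) = T.  The paths from i and from j each leave V along an arc of the cut;
-- if both arcs start at the same vertex, i and j lie on one such route, contradicting
-- ⟨i,j⟩ ∈ 𝒦.

open import Defs
open import Data.Nat using (ℕ; zero; suc) renaming (_≤_ to _≤ℕ_)
open import Data.Fin using (Fin)
open import Data.Fin.Properties using (_≟_; suc-injective)
open import Data.Fin.Induction using (spo-wellFounded; spo-noetherian)
open import Data.Bool using (Bool; true; false; _∧_; not)
open import Data.Product using (_×_; _,_; proj₁; proj₂; Σ; ∃-syntax)
open import Data.Sum using (_⊎_; inj₁; inj₂)
open import Data.Empty using (⊥-elim)
open import Data.List using (List)
open import Data.List.Membership.Propositional using (_∈_)
open import Data.List.Relation.Binary.Subset.Propositional using (_⊆_)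
open import Data.List.Relation.Unary.Any using (here; there)
open import Data.List.Relation.Unary.All as All using (tabulate)
open import Data.List.Relation.Unary.AllPairs using ([]; _∷_)
open import Data.List.Relation.Unary.Unique.Propositional using (Unique)
open import Function using (_∘_; id; flip)
open import Induction.WellFounded using (Acc; acc)
open import Relation.Nullary using (yes; no; ¬_)
open import Relation.Binary.Bundles using (Poset)
open import Relation.Binary.Structures using (IsTotalOrder; IsStrictPartialOrder)
open import Relation.Binary.PropositionalEquality
  using (_≡_; _≢_; refl; sym; trans; cong; cong₂; subst; subst₂; module ≡-Reasoning)
import Relation.Binary.Construct.NonStrictToStrict as NonStrictToStrict
import Relation.Binary.Construct.On as On
import Relation.Binary.Reasoning.PartialOrder as ≤-Reasoning
open import Algebra.Bundles using (CommutativeRing)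
open import Algebra.Structures using (IsCommutativeRing)
import Algebra.Properties.Group as GroupProperties
import Algebra.Properties.Ring as RingProperties

module OrderedFieldProperties (𝔽 : OrderedField) where
  open OrderedField 𝔽
  open IsCommutativeRing isCommutativeRing
    using (+-comm; +-assoc; +-identityˡ; +-identityʳ; -‿inverseˡ; -‿inverseʳ; zeroʳ; *-identityʳ)
  open IsTotalOrder isTotalOrder using (antisym; total; isPartialOrder)
    renaming (refl to ≤-refl; reflexive to ≤-reflexive; trans to ≤-trans)

  commutativeRing : CommutativeRing _ _
  commutativeRing = record { isCommutativeRing = isCommutativeRing }

  open GroupProperties (CommutativeRing.+-group commutativeRing)
    using (⁻¹-involutive; x∙y⁻¹≈ε⇒x≈y; //-rightDividesˡ)
  open RingProperties (CommutativeRing.ring commutativeRing) using (-1*x≈-x)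

  a-b≡0⇒a≡b : ∀ {a b} → a - b ≡ 0# → a ≡ b
  a-b≡0⇒a≡b = x∙y⁻¹≈ε⇒x≈y _ _

  a-b≡c⇒a≡c+b : ∀ {a b c} → a - b ≡ c → a ≡ c + b
  a-b≡c⇒a≡c+b {a} {b} refl = sym (//-rightDividesˡ b a)

  a+[b-a]≡b : ∀ a b → a + (b - a) ≡ b
  a+[b-a]≡b a b = trans (+-comm a (b - a)) (//-rightDividesˡ a b)

  +-monoʳ-≤ : ∀ {a b} c → a ≤ b → c + a ≤ c + b
  +-monoʳ-≤ {a} {b} c a≤b = subst₂ _≤_ (+-comm a c) (+-comm b c) (+-monoˡ-≤ c a≤b)

  +-mono-≤ : ∀ {a b c e} → a ≤ b → c ≤ e → a + c ≤ b + e
  +-mono-≤ {b = b} {c} a≤b c≤e = ≤-trans (+-monoˡ-≤ c a≤b) (+-monoʳ-≤ b c≤e)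

  +-cancelˡ-≤ : ∀ {a b c} → a + b ≤ a + c → b ≤ c
  +-cancelˡ-≤ {a} {b} {c} a+b≤a+c = subst₂ _≤_ (-a+[a+z]≡z b) (-a+[a+z]≡z c) (+-monoʳ-≤ (- a) a+b≤a+c)
    where
    -a+[a+z]≡z : ∀ z → - a + (a + z) ≡ z
    -a+[a+z]≡z z = trans (sym (+-assoc (- a) a z)) (trans (cong (_+ z) (-‿inverseˡ a)) (+-identityˡ z))

  0≤1 : 0# ≤ 1#
  0≤1 with total 0# 1#
  ... | inj₁ 0≤1 = 0≤1
  ... | inj₂ 1≤0 = ⊥-elim (0≢1 (antisym (subst (0# ≤_) [-1]*[-1]≡1 (*-nonneg 0≤-1 0≤-1)) 1≤0))
    where
    0≤-1 : 0# ≤ - 1#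
    0≤-1 = subst₂ _≤_ (-‿inverseʳ 1#) (+-identityˡ (- 1#)) (+-monoˡ-≤ (- 1#) 1≤0)
    [-1]*[-1]≡1 : - 1# * - 1# ≡ 1#
    [-1]*[-1]≡1 = trans (-1*x≈-x (- 1#)) (⁻¹-involutive 1#)

  1+1≰1 : ¬ (1# + 1# ≤ 1#)
  1+1≰1 2≤1 = 0≢1 (antisym 0≤1 (+-cancelˡ-≤ (subst (1# + 1# ≤_) (sym (+-identityʳ 1#)) 2≤1)))

  poset : Poset _ _ _
  poset = record { isPartialOrder = isPartialOrder }

  <-isStrictPartialOrder : IsStrictPartialOrder _≡_ _<_
  <-isStrictPartialOrder = NonStrictToStrict.<-isStrictPartialOrder _≡_ _≤_ isPartialOrder

  <⇒≱ : ∀ {a b} → a < b → ¬ (b ≤ a)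
  <⇒≱ = NonStrictToStrict.<⇒≱ _≡_ _≤_ antisym

  a<a+d : ∀ {a d} → 0# < d → a < a + d
  a<a+d {a} (0≤d , 0≢d) =
    subst (_≤ a + _) (+-identityʳ a) (+-monoʳ-≤ a 0≤d) ,
    λ a≡a+d → 0≢d (+-cancelˡ-≡ (trans (+-identityʳ a) a≡a+d))
    where
    +-cancelˡ-≡ : ∀ {b c} → a + b ≡ a + c → b ≡ c
    +-cancelˡ-≡ e = antisym (+-cancelˡ-≤ (≤-reflexive e)) (+-cancelˡ-≤ (≤-reflexive (sym e)))

  binary⇒nonneg : ∀ {a} → binary a → 0# ≤ a
  binary⇒nonneg (inj₁ refl) = ≤-refl
  binary⇒nonneg (inj₂ refl) = 0≤1

  [_]-nonneg : ∀ b {a} → 0# ≤ a → 0# ≤ [ b ] a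
  [ true  ]-nonneg 0≤a = 0≤a
  [ false ]-nonneg _   = ≤-refl

  [_]-∧ : ∀ b c a → [ b ∧ c ] a ≡ [ c ] ([ b ] a)
  [ true  ]-∧ c a = refl
  [ false ]-∧ true  a = refl
  [ false ]-∧ false a = refl

  [_]-*ʳ : ∀ b c a → [ b ] (c * a) ≡ c * [ b ] a
  [ true  ]-*ʳ c a = refl
  [ false ]-*ʳ c a = sym (zeroʳ c)

  ∑-nonneg : ∀ {n} (g : Fin n → Carrier) → (∀ k → 0# ≤ g k) → 0# ≤ ∑ g
  ∑-nonneg {zero}  g 0≤g = ≤-refl
  ∑-nonneg {suc n} g 0≤g =
    subst (_≤ ∑ g) (+-identityʳ 0#) (+-mono-≤ (0≤g Fin.zero) (∑-nonneg (g ∘ Fin.suc) (0≤g ∘ Fin.suc)))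

  ∑-≥-term : ∀ {n} (g : Fin n → Carrier) → (∀ k → 0# ≤ g k) → ∀ k → g k ≤ ∑ g
  ∑-≥-term g 0≤g Fin.zero =
    subst (_≤ ∑ g) (+-identityʳ _) (+-monoʳ-≤ _ (∑-nonneg (g ∘ Fin.suc) (0≤g ∘ Fin.suc)))
  ∑-≥-term g 0≤g (Fin.suc k) =
    subst (_≤ ∑ g) (+-identityˡ _) (+-mono-≤ (0≤g Fin.zero) (∑-≥-term (g ∘ Fin.suc) (0≤g ∘ Fin.suc) k))

  ∑-≥-two-terms : ∀ {n} (g : Fin n → Carrier) → (∀ k → 0# ≤ g k) →
                  ∀ {k k′} → k ≢ k′ → g k + g k′ ≤ ∑ g
  ∑-≥-two-terms g 0≤g {Fin.zero} {Fin.zero} k≢k′ = ⊥-elim (k≢k′ refl)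
  ∑-≥-two-terms g 0≤g {Fin.zero} {Fin.suc k′} _ =
    +-monoʳ-≤ _ (∑-≥-term (g ∘ Fin.suc) (0≤g ∘ Fin.suc) k′)
  ∑-≥-two-terms g 0≤g {Fin.suc k} {Fin.zero} _ =
    subst (_≤ ∑ g) (+-comm _ _) (+-monoʳ-≤ _ (∑-≥-term (g ∘ Fin.suc) (0≤g ∘ Fin.suc) k))
  ∑-≥-two-terms g 0≤g {Fin.suc k} {Fin.suc k′} k≢k′ =
    subst (_≤ ∑ g) (+-identityˡ _)
      (+-mono-≤ (0≤g Fin.zero) (∑-≥-two-terms (g ∘ Fin.suc) (0≤g ∘ Fin.suc) (k≢k′ ∘ cong Fin.suc)))

  ∑-zero : ∀ {n} (g : Fin n → Carrier) → (∀ k → g k ≡ 0#) → ∑ g ≡ 0#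
  ∑-zero {zero}  g g≡0 = refl
  ∑-zero {suc n} g g≡0 =
    trans (cong₂ _+_ (g≡0 Fin.zero) (∑-zero (g ∘ Fin.suc) (g≡0 ∘ Fin.suc))) (+-identityʳ 0#)

  ∑-single : ∀ {n} (g : Fin n → Carrier) k → (∀ j → j ≢ k → g j ≡ 0#) → ∑ g ≡ g k
  ∑-single g Fin.zero g≡0 =
    trans (cong (g Fin.zero +_) (∑-zero (g ∘ Fin.suc) (λ j → g≡0 (Fin.suc j) (λ ())))) (+-identityʳ _)
  ∑-single g (Fin.suc k) g≡0 =
    trans (cong₂ _+_ (g≡0 Fin.zero (λ ()))
                     (∑-single (g ∘ Fin.suc) k (λ j j≢k → g≡0 (Fin.suc j) (j≢k ∘ suc-injective))))
          (+-identityˡ _)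

  ∑≡0⇒term≡0 : ∀ {n} (g : Fin n → Carrier) → (∀ k → 0# ≤ g k) → ∑ g ≡ 0# → ∀ k → g k ≡ 0#
  ∑≡0⇒term≡0 g 0≤g ∑≡0 k = antisym (subst (g k ≤_) ∑≡0 (∑-≥-term g 0≤g k)) (0≤g k)

  ∑≢0⇒∃≡1 : ∀ {n} (g : Fin n → Carrier) → (∀ k → binary (g k)) → ∑ g ≢ 0# → ∃[ k ] g k ≡ 1#
  ∑≢0⇒∃≡1 {zero}  g g-binary ∑≢0 = ⊥-elim (∑≢0 refl)
  ∑≢0⇒∃≡1 {suc n} g g-binary ∑≢0 with g-binary Fin.zero
  ... | inj₂ g0≡1 = Fin.zero , g0≡1
  ... | inj₁ g0≡0 with ∑≢0⇒∃≡1 (g ∘ Fin.suc) (g-binary ∘ Fin.suc) rest≢0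
    where
    rest≢0 : ∑ (g ∘ Fin.suc) ≢ 0#
    rest≢0 rest≡0 = ∑≢0 (trans (cong₂ _+_ g0≡0 rest≡0) (+-identityʳ 0#))
  ... | k , gk≡1 = Fin.suc k , gk≡1

  module _ {n} {g : Fin n → Carrier} (g-binary : ∀ k → binary (g k)) (∑≡1 : ∑ g ≡ 1#) where

    ∑≡1⇒∃≡1 : ∃[ k ] g k ≡ 1#
    ∑≡1⇒∃≡1 = ∑≢0⇒∃≡1 g g-binary (λ ∑≡0 → 0≢1 (trans (sym ∑≡0) ∑≡1))

    ∑≡1⇒≡1-unique : ∀ {k k′} → g k ≡ 1# → g k′ ≡ 1# → k ≡ k′
    ∑≡1⇒≡1-unique {k} {k′} gk≡1 gk′≡1 with k ≟ k′
    ... | yes k≡k′ = k≡k′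
    ... | no k≢k′ = ⊥-elim (1+1≰1 (subst₂ _≤_ (cong₂ _+_ gk≡1 gk′≡1) ∑≡1
                                     (∑-≥-two-terms g (binary⇒nonneg ∘ g-binary) k≢k′)))

    ∑≡1⇒∑-supported : ∀ {k} → g k ≡ 1# →
                      (h : Fin n → Carrier) → (∀ j → g j ≡ 0# → h j ≡ 0#) → ∑ h ≡ h k
    ∑≡1⇒∑-supported gk≡1 h h≡0 = ∑-single h _ h-off
      where
      h-off : ∀ j → j ≢ _ → h j ≡ 0#
      h-off j j≢k with g-binary j
      ... | inj₁ gj≡0 = h≡0 j gj≡0
      ... | inj₂ gj≡1 = ⊥-elim (j≢k (∑≡1⇒≡1-unique gj≡1 gk≡1))

module FeasibleSolution (𝔽 : OrderedField) where
  open OrderedField 𝔽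
  open OrderedFieldProperties 𝔽
  open IsCommutativeRing isCommutativeRing using (+-comm; +-identityˡ; +-identityʳ; zeroʳ; *-identityʳ)
  open IsTotalOrder isTotalOrder using (antisym) renaming (refl to ≤-refl; trans to ≤-trans)

  module _ {n : ℕ} {A : Fin n → Fin n → Bool} {s t : Fin n} (s≢t : s ≢ t)
           {isS : Fin n → Bool} {d : Fin n → Fin n → Carrier} {m : ℕ} {T : Carrier}
           (d>0 : ∀ i j → A i j ≡ true → 0# < d i j)
           {R x f : Fin n → Fin n → Carrier} {y : Fin n → Carrier} {φ : Carrier}
           (feasible : STOP.Feasible 𝔽 A s t isS d m T R x y f φ) where

    open STOP 𝔽 A s t isS d m T
    open Feasible feasible

    -- Feasibility says nothing about x off the arcs of A; x̂ zeroes those junk values, and then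
    -- out x a = ∑ (x̂ a) and inn x b = ∑ (λ a → x̂ a b) definitionally.
    x̂ : Fin n → Fin n → Carrier
    x̂ a b = [ A a b ] x a b

    x̂-binary : ∀ a b → binary (x̂ a b)
    x̂-binary a b with A a b in arc
    ... | true  = x-binary a b arc
    ... | false = inj₁ refl

    x̂-nonneg : ∀ a b → 0# ≤ x̂ a b
    x̂-nonneg a b = binary⇒nonneg (x̂-binary a b)

    _↝_ : Fin n → Fin n → Set
    a ↝ b = x̂ a b ≡ 1#

    ↝⇒Arc : ∀ {a b} → a ↝ b → Arc a b
    ↝⇒Arc {a} {b} a↝b with A a b
    ... | true  = refl
    ... | false = ⊥-elim (0≢1 a↝b)

    ↝⇒x≡1 : ∀ {a b} → a ↝ b → x a b ≡ 1#
    ↝⇒x≡1 {a} {b} a↝b = trans (cong ([_] x a b) (sym (↝⇒Arc a↝b))) a↝b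

    ↝⇒out≢0 : ∀ {a b} → a ↝ b → out x a ≢ 0#
    ↝⇒out≢0 {a} {b} a↝b out≡0 = 0≢1 (trans (sym (∑≡0⇒term≡0 (x̂ a) (x̂-nonneg a) out≡0 b)) a↝b)

    ↝⇒in≢0 : ∀ {a b} → a ↝ b → inn x b ≢ 0#
    ↝⇒in≢0 {a} {b} a↝b in≡0 =
      0≢1 (trans (sym (∑≡0⇒term≡0 (λ c → x̂ c b) (λ c → x̂-nonneg c b) in≡0 a)) a↝b)

    ↝-tail≢t : ∀ {a b} → a ↝ b → a ≢ t
    ↝-tail≢t a↝b refl = ↝⇒out≢0 a↝b t-out

    ↝-head≢s : ∀ {a b} → a ↝ b → b ≢ s
    ↝-head≢s a↝b refl = ↝⇒in≢0 a↝b s-in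

    Active : Fin n → Set
    Active v = Inner v × y v ≡ 1#

    inn≡out : ∀ {v} → Inner v → inn x v ≡ out x v
    inn≡out {v} v-inner = sym (a-b≡0⇒a≡b (conserve v v-inner))

    active-out≡1 : ∀ {v} → Active v → out x v ≡ 1#
    active-out≡1 {v} (v-inner , yv≡1) = trans (out-deg v v-inner) yv≡1

    active-in≡1 : ∀ {v} → Active v → inn x v ≡ 1#
    active-in≡1 av = trans (inn≡out (proj₁ av)) (active-out≡1 av)

    out≢0⇒active : ∀ {v} → Inner v → out x v ≢ 0# → Active v
    out≢0⇒active {v} v-inner out≢0 with y-binary v
    ... | inj₁ yv≡0 = ⊥-elim (out≢0 (trans (out-deg v v-inner) yv≡0))
    ... | inj₂ yv≡1 = v-inner , yv≡1

    ↝-tail-active : ∀ {a b} → a ↝ b → a ≢ s → Active a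
    ↝-tail-active a↝b a≢s = out≢0⇒active (a≢s , ↝-tail≢t a↝b) (↝⇒out≢0 a↝b)

    ↝-head-active : ∀ {a b} → a ↝ b → b ≢ t → Active b
    ↝-head-active a↝b b≢t = out≢0⇒active b-inner (↝⇒in≢0 a↝b ∘ trans (inn≡out b-inner))
      where
      b-inner : Inner _
      b-inner = ↝-head≢s a↝b , b≢t

    successor : ∀ {v} → Active v → ∃[ w ] v ↝ w
    successor {v} av = ∑≡1⇒∃≡1 (x̂-binary v) (active-out≡1 av)

    predecessor : ∀ {v} → Active v → ∃[ p ] p ↝ v
    predecessor {v} av = ∑≡1⇒∃≡1 (λ p → x̂-binary p v) (active-in≡1 av)

    predecessor-unique : ∀ {v a b} → Active v → a ↝ v → b ↝ v → a ≡ b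
    predecessor-unique {v} av = ∑≡1⇒≡1-unique (λ p → x̂-binary p v) (active-in≡1 av)

    -- The inflow of f into v is the time still available on arrival at v.
    π : Fin n → Carrier
    π = inn f

    f-vanishes : ∀ {a b} → x̂ a b ≡ 0# → [ A a b ] f a b ≡ 0#
    f-vanishes {a} {b} with A a b in arc | a ≟ s
    ... | false | _        = λ _ → refl
    ... | true  | yes refl = λ x≡0 → trans (f-source b arc) (trans (cong (_ *_) x≡0) (zeroʳ _))
    ... | true  | no a≢s   = λ x≡0 →
      antisym (subst (f a b ≤_) (trans (cong (_ *_) x≡0) (zeroʳ _)) (f-upper a b arc a≢s)) (f-nonneg a b arc)

    π-pred : ∀ {p v} → Active v → p ↝ v → π v ≡ f p v
    π-pred {p} {v} av p↝v =
      trans (∑≡1⇒∑-supported (λ a → x̂-binary a v) (active-in≡1 av) p↝v _ (λ _ → f-vanishes))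
            (cong ([_] f p v) (↝⇒Arc p↝v))

    π-step : ∀ {v w} → Active v → v ↝ w → π v ≡ f v w + d v w
    π-step {v} {w} av v↝w = begin
      π v                   ≡⟨ a-b≡c⇒a≡c+b (f-balance v (proj₁ av)) ⟩
      out dx v + out f v    ≡⟨ +-comm _ _ ⟩
      out f v + out dx v    ≡⟨ cong₂ _+_ out-f out-dx ⟩
      f v w + d v w         ∎
      where
      open ≡-Reasoning
      dx : Fin n → Fin n → Carrier
      dx a b = d a b * x a b
      supported : ∀ (h : Fin n → Carrier) → (∀ j → x̂ v j ≡ 0# → h j ≡ 0#) → ∑ h ≡ h w
      supported = ∑≡1⇒∑-supported (x̂-binary v) (active-out≡1 av) v↝w
      out-f : out f v ≡ f v w
      out-f = trans (supported _ (λ _ → f-vanishes)) (cong ([_] f v w) (↝⇒Arc v↝w))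
      dx-vanishes : ∀ j → x̂ v j ≡ 0# → [ A v j ] dx v j ≡ 0#
      dx-vanishes j x≡0 = trans ([ A v j ]-*ʳ _ _) (trans (cong (d v j *_) x≡0) (zeroʳ _))
      out-dx : out dx v ≡ d v w
      out-dx = begin
        out dx v           ≡⟨ supported _ dx-vanishes ⟩
        [ A v w ] dx v w   ≡⟨ [ A v w ]-*ʳ _ _ ⟩
        d v w * x̂ v w      ≡⟨ cong (d v w *_) v↝w ⟩
        d v w * 1#         ≡⟨ *-identityʳ _ ⟩
        d v w              ∎

    π-decreasing : ∀ {v w} → Active v → v ↝ w → Active w → π w < π v
    π-decreasing {v} {w} av v↝w aw =
      subst₂ _<_ (sym (π-pred aw v↝w)) (sym (π-step av v↝w)) (a<a+d (d>0 v w (↝⇒Arc v↝w)))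

    _⊏_ : Fin n → Fin n → Set
    w ⊏ v = π w < π v

    ⊏-isStrictPartialOrder : IsStrictPartialOrder (λ v w → π v ≡ π w) _⊏_
    ⊏-isStrictPartialOrder = On.isStrictPartialOrder π <-isStrictPartialOrder

    data SupportPath : Fin n → Set where
      end  : ∀ {v} → Active v → v ↝ t → SupportPath v
      step : ∀ {v w} → Active v → v ↝ w → SupportPath w → SupportPath v

    toWalk : ∀ {v} → SupportPath v → Walk v t
    toWalk (end _ v↝t)    = ↝⇒Arc v↝t ∷ []
    toWalk (step _ v↝w c) = ↝⇒Arc v↝w ∷ toWalk c

    nodes : ∀ {v} → SupportPath v → List (Fin n)
    nodes c = vertices (toWalk c)

    head-∈ : ∀ {v} (c : SupportPath v) → v ∈ nodes c
    head-∈ (end _ _)    = here refl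
    head-∈ (step _ _ _) = here refl

    head-active : ∀ {v} → SupportPath v → Active v
    head-active (end av _)    = av
    head-active (step av _ _) = av

    supportPath : ∀ v → Active v → SupportPath v
    supportPath v = go v (spo-wellFounded ⊏-isStrictPartialOrder v)
      where
      go : ∀ v → Acc _⊏_ v → Active v → SupportPath v
      go v (acc rec) av with successor av
      ... | w , v↝w with w ≟ t
      ...   | yes refl = end av v↝w
      ...   | no w≢t   = step av v↝w (go w (rec (π-decreasing av v↝w aw)) aw)
        where
        aw : Active w
        aw = ↝-head-active v↝w w≢t

    ∈-nodes⇒≡t⊎active : ∀ {v u} (c : SupportPath v) → u ∈ nodes c → u ≡ t ⊎ (Active u × π u ≤ π v)
    ∈-nodes⇒≡t⊎active (end av _)    (here refl)         = inj₂ (av , ≤-refl)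
    ∈-nodes⇒≡t⊎active (end _ _)     (there (here refl)) = inj₁ refl
    ∈-nodes⇒≡t⊎active (step av _ _) (here refl)         = inj₂ (av , ≤-refl)
    ∈-nodes⇒≡t⊎active (step av v↝w c) (there u∈c) with ∈-nodes⇒≡t⊎active c u∈c
    ... | inj₁ u≡t          = inj₁ u≡t
    ... | inj₂ (au , πu≤πw) = inj₂ (au , ≤-trans πu≤πw (proj₁ (π-decreasing av v↝w (head-active c))))

    ∈-nodes⇒≢s : ∀ {v u} (c : SupportPath v) → u ∈ nodes c → s ≢ u
    ∈-nodes⇒≢s c u∈c refl with ∈-nodes⇒≡t⊎active c u∈c
    ... | inj₁ s≡t      = s≢t s≡t
    ... | inj₂ (as , _) = proj₁ (proj₁ as) refl

    nodes-unique : ∀ {v} (c : SupportPath v) → Unique (nodes c)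
    nodes-unique (end av _)      = (proj₂ (proj₁ av) All.∷ All.[]) ∷ (All.[] ∷ [])
    nodes-unique (step av v↝w c) = tabulate v∉c ∷ nodes-unique c
      where
      v∉c : ∀ {u} → u ∈ nodes c → _ ≢ u
      v∉c u∈c refl with ∈-nodes⇒≡t⊎active c u∈c
      ... | inj₁ v≡t         = proj₂ (proj₁ av) v≡t
      ... | inj₂ (_ , πv≤πw) = <⇒≱ (π-decreasing av v↝w (head-active c)) πv≤πw

    time-≤-π : ∀ {v} (c : SupportPath v) → time (toWalk c) ≤ π v
    time-≤-π {v} (end av v↝t) = begin
      d v t + 0#       ≡⟨ +-comm _ _ ⟩
      0# + d v t       ≤⟨ +-monoˡ-≤ (d v t) (f-nonneg v t (↝⇒Arc v↝t)) ⟩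
      f v t + d v t    ≡⟨ π-step av v↝t ⟨
      π v              ∎
      where open ≤-Reasoning poset
    time-≤-π {v} (step {w = w} av v↝w c) = begin
      d v w + time (toWalk c)  ≤⟨ +-monoʳ-≤ (d v w) (time-≤-π c) ⟩
      d v w + π w              ≡⟨ cong (d v w +_) (π-pred (head-active c) v↝w) ⟩
      d v w + f v w            ≡⟨ +-comm _ _ ⟩
      f v w + d v w            ≡⟨ π-step av v↝w ⟨
      π v                      ∎
      where open ≤-Reasoning poset

    ∈-nodes⇒head⊎predecessor : ∀ {v u} (c : SupportPath v) → u ∈ nodes c →
                          u ≡ v ⊎ ∃[ q ] q ∈ nodes c × q ↝ u
    ∈-nodes⇒head⊎predecessor (end _ _)           (here refl)         = inj₁ refl
    ∈-nodes⇒head⊎predecessor (end {v} _ v↝t)     (there (here refl)) = inj₂ (v , here refl , v↝t)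
    ∈-nodes⇒head⊎predecessor (step _ _ _)        (here refl)         = inj₁ refl
    ∈-nodes⇒head⊎predecessor (step {v} _ v↝w c)  (there u∈c) with ∈-nodes⇒head⊎predecessor c u∈c
    ... | inj₁ refl             = inj₂ (v , here refl , v↝w)
    ... | inj₂ (q , q∈c , q↝u)  = inj₂ (q , there q∈c , q↝u)

    record SourcePath : Set where
      constructor _◂_
      field
        {first} : Fin n
        leaves-s : s ↝ first
        onward   : SupportPath first

    open SourcePath

    route : SourcePath → Route
    route (s↝k ◂ c) = path (↝⇒Arc s↝k ∷ toWalk c) (tabulate (∈-nodes⇒≢s c) ∷ nodes-unique c)

    route-time : ∀ r → pathTime (route r) ≤ T
    route-time (_◂_ {k} s↝k c) = begin
      d s k + time (toWalk c)  ≤⟨ +-monoʳ-≤ (d s k) (time-≤-π c) ⟩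
      d s k + π k              ≡⟨ cong (d s k +_) (π-pred (head-active c) s↝k) ⟩
      d s k + f s k            ≡⟨ cong (d s k +_) f-sk ⟩
      d s k + (T - d s k)      ≡⟨ a+[b-a]≡b (d s k) T ⟩
      T                        ∎
      where
      open ≤-Reasoning poset
      f-sk : f s k ≡ T - d s k
      f-sk = trans (f-source k (↝⇒Arc s↝k)) (trans (cong (_ *_) (↝⇒x≡1 s↝k)) (*-identityʳ _))

    extend : ∀ {v} (c : SupportPath v) → Σ SourcePath λ r → nodes c ⊆ nodes (onward r)
    extend c = go _ (spo-noetherian ⊏-isStrictPartialOrder _) c
      where
      go : ∀ v → Acc (flip _⊏_) v → (c : SupportPath v) → Σ SourcePath λ r → nodes c ⊆ nodes (onward r)
      go v (acc rec) c with predecessor (head-active c)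
      ... | p , p↝v with p ≟ s
      ...   | yes refl = (p↝v ◂ c) , id
      ...   | no p≢s   with go p (rec (π-decreasing ap p↝v (head-active c))) (step ap p↝v c)
        where
        ap : Active p
        ap = ↝-tail-active p↝v p≢s
      ...     | r , c′⊆r = r , c′⊆r ∘ there

    ∈-onward-predecessor : ∀ r {u p} → u ∈ nodes (onward r) → Active u → p ↝ u → Active p →
                           p ∈ nodes (onward r)
    ∈-onward-predecessor (s↝k ◂ c) u∈c au p↝u ap with ∈-nodes⇒head⊎predecessor c u∈c
    ... | inj₁ refl            = ⊥-elim (proj₁ (proj₁ ap) (predecessor-unique au p↝u s↝k))
    ... | inj₂ (q , q∈c , q↝u) = subst (_∈ nodes c) (predecessor-unique au q↝u p↝u) q∈c

    meets⇒head-∈-onward : ∀ {i u} (c : SupportPath i) r →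
                          u ∈ nodes c → u ≢ t → u ∈ nodes (onward r) → i ∈ nodes (onward r)
    meets⇒head-∈-onward (end _ _)    r (here refl)         _   u∈r = u∈r
    meets⇒head-∈-onward (end _ _)    r (there (here refl)) u≢t _   = ⊥-elim (u≢t refl)
    meets⇒head-∈-onward (step _ _ _) r (here refl)         _   u∈r = u∈r
    meets⇒head-∈-onward (step ai i↝w c) r (there u∈c) u≢t u∈r =
      ∈-onward-predecessor r (meets⇒head-∈-onward c r u∈c u≢t u∈r) (head-active c) i↝w ai

    record Exit (V : Fin n → Bool) (a : Fin n) : Set where
      field
        {head}  : Fin n
        arc     : a ↝ head
        tail∈V  : V a ≡ true
        head∉V  : V head ≡ false

    exit : ∀ {V v} → V t ≡ false → (c : SupportPath v) → V v ≡ true → ∃[ a ] a ∈ nodes c × Exit V a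
    exit t∉V (end _ v↝t) v∈V = _ , here refl , record { arc = v↝t ; tail∈V = v∈V ; head∉V = t∉V }
    exit {V} t∉V (step {w = w} _ v↝w c) v∈V with V w in w-in-V
    ... | false = _ , here refl , record { arc = v↝w ; tail∈V = v∈V ; head∉V = w-in-V }
    ... | true with exit t∉V c w-in-V
    ...   | a , a∈c , a-exit = a , there a∈c , a-exit

    module _ (V : Fin n → Bool) where

      row : Fin n → Carrier
      row a = ∑ λ b → [ A a b ∧ V a ∧ not (V b) ] x a b

      row-term-nonneg : ∀ a b → 0# ≤ [ A a b ∧ V a ∧ not (V b) ] x a b
      row-term-nonneg a b = subst (0# ≤_) (sym ([ A a b ]-∧ _ _)) ([ V a ∧ not (V b) ]-nonneg (x̂-nonneg a b))

      row-nonneg : ∀ a → 0# ≤ row a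
      row-nonneg a = ∑-nonneg _ (row-term-nonneg a)

      exit⇒1≤row : ∀ {a} → Exit V a → 1# ≤ row a
      exit⇒1≤row {a} e = subst (_≤ row a) term≡1 (∑-≥-term _ (row-term-nonneg a) head)
        where
        open Exit e
        term≡1 : [ A a head ∧ V a ∧ not (V head) ] x a head ≡ 1#
        term≡1 = trans ([ A a head ]-∧ _ _)
                       (trans (cong₂ (λ p q → [ p ∧ not q ] x̂ a head) tail∈V head∉V) arc)

      cut-nonneg : 0# ≤ cut x V
      cut-nonneg = ∑-nonneg row row-nonneg

      exit⇒1≤cut : ∀ {a} → Exit V a → 1# ≤ cut x V
      exit⇒1≤cut {a} e = ≤-trans (exit⇒1≤row e) (∑-≥-term row row-nonneg a)

      exits⇒2≤cut : ∀ {a a′} → a ≢ a′ → Exit V a → Exit V a′ → 1# + 1# ≤ cut x V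
      exits⇒2≤cut a≢a′ e e′ =
        ≤-trans (+-mono-≤ (exit⇒1≤row e) (exit⇒1≤row e′)) (∑-≥-two-terms row row-nonneg a≢a′)

      module _ (t∉V : V t ≡ false) where

        active∈V⇒1≤cut : ∀ {v} → Active v → V v ≡ true → 1# ≤ cut x V
        active∈V⇒1≤cut av v∈V with exit t∉V (supportPath _ av) v∈V
        ... | _ , _ , e = exit⇒1≤cut e

        -- If both exits start at the same vertex a, the support paths of i and j meet at a, so
        -- both i and j lie on the route that extends the path of j back to s.
        conflicting∈V⇒2≤cut : ∀ {i j} → Conflicting i j → Active i → Active j →
                              V i ≡ true → V j ≡ true → 1# + 1# ≤ cut x V
        conflicting∈V⇒2≤cut {i} {j} (_ , _ , _ , conflict) ai aj i∈V j∈V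
          with supportPath i ai | supportPath j aj
        ... | cᵢ | cⱼ with exit t∉V cᵢ i∈V | exit t∉V cⱼ j∈V
        ...   | a , a∈cᵢ , e | a′ , a′∈cⱼ , e′ with a ≟ a′
        ...     | no a≢a′ = exits⇒2≤cut a≢a′ e e′
        ...     | yes refl with extend cⱼ
        ...       | r , cⱼ⊆r = ⊥-elim (<⇒≱ (conflict (route r) (there i∈r) (there j∈r)) (route-time r))
          where
          a≢t : a ≢ t
          a≢t refl with trans (sym (Exit.tail∈V e)) t∉V
          ... | ()
          i∈r : i ∈ nodes (onward r)
          i∈r = meets⇒head-∈-onward cᵢ r a∈cᵢ a≢t (cⱼ⊆r a′∈cⱼ)
          j∈r : j ∈ nodes (onward r)
          j∈r = cⱼ⊆r (head-∈ cⱼ)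

        y+y≤cut : ∀ {i j} → Conflicting i j → V i ≡ true → V j ≡ true → y i + y j ≤ cut x V
        y+y≤cut {i} {j} ij∈𝒦@(i-inner , j-inner , _) i∈V j∈V with y-binary i | y-binary j
        ... | inj₁ yi≡0 | inj₁ yj≡0 rewrite yi≡0 | yj≡0 =
          subst (_≤ cut x V) (sym (+-identityʳ 0#)) cut-nonneg
        ... | inj₂ yi≡1 | inj₁ yj≡0 rewrite yi≡1 | yj≡0 =
          subst (_≤ cut x V) (sym (+-identityʳ 1#)) (active∈V⇒1≤cut (i-inner , yi≡1) i∈V)
        ... | inj₁ yi≡0 | inj₂ yj≡1 rewrite yi≡0 | yj≡1 =
          subst (_≤ cut x V) (sym (+-identityˡ 1#)) (active∈V⇒1≤cut (j-inner , yj≡1) j∈V)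
        ... | inj₂ yi≡1 | inj₂ yj≡1 rewrite yi≡1 | yj≡1 =
          conflicting∈V⇒2≤cut ij∈𝒦 (i-inner , yi≡1) (j-inner , yj≡1) i∈V j∈V

corollary2 : (𝔽 : OrderedField) → let open OrderedField 𝔽 in
    {n : ℕ} (A : Fin n → Fin n → Bool) (s t : Fin n) → s ≢ t →
    (isS : Fin n → Bool) (d : Fin n → Fin n → Carrier) (m : ℕ) (T : Carrier) →
    (∀ i j → A i j ≡ true → 0# < d i j) → 1 ≤ℕ m →
    let open STOP 𝔽 A s t isS d m T in
    (R : Fin n → Fin n → Carrier) → (∀ i j → IsMinPathTime i j (R i j)) →
    (x : Fin n → Fin n → Carrier) (y : Fin n → Carrier)
    (f : Fin n → Fin n → Carrier) (φ : Carrier) →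
    Feasible R x y f φ →
    ∀ i j → Conflicting i j →
    ∀ (V : Fin n → Bool) → V t ≡ false → V i ≡ true → V j ≡ true →
    y i + y j ≤ cut x V
corollary2 𝔽 A s t s≢t isS d m T d>0 _ R _ x y f φ feasible i j ij∈𝒦 V t∉V i∈V j∈V =
  FeasibleSolution.y+y≤cut 𝔽 s≢t d>0 feasible V t∉V ij∈𝒦 i∈V j∈V
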